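{- Let $n\ge 1$ and let $v=(v_1,\dots,v_n)$ be a vector of positive integers. Then there exists an $n\times n$ alternating sign matrix whose weighted projection is $v$ if and only if $v \preceq (n,n-1,\dots,2,1)$.
   Context: An alternating sign matrix (ASM) is a square $(0,1,-1)$-matrix in which, in each row and each column, the nonzero entries alternate in sign and sum to $1$. For an $n\times n$ ASM $A$, its weighted projection is the row vector $v(A)=z_n^T A$, where $z_n=(n,n-1,\dots,2,1)^T$. A vector $x=(x_1,\dots,x_n)$ is majorized by $y=(y_1,\dots,y_n)$, written $x\preceq y$, if for every $k=1,\dots,n$ we have $\sum_{i=1}^k x^{\downarrow}_i \le \sum_{i=1}^k y^{\downarrow}_i$, with equality for $k=n$, where $x^{\downarrow}_i$ denotes the $i$-th largest entry of $x$ (and similarly for $y$). -}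

module Defs where

open import Data.Nat using (ℕ; zero; suc)
open import Data.Fin using (Fin; toℕ)
open import Data.Integer using (ℤ; +_; -[1+_]; _+_; _*_; _≤_; _<_; 0ℤ; 1ℤ; -1ℤ)
import Data.Integer.Properties as ℤP
open import Data.List using (List; []; _∷_; take; foldr; filter)
open import Data.Vec.Functional using (Vector; toList)
open import Data.Product using (_×_; Σ)
open import Data.Sum using (_⊎_)
open import Relation.Binary.PropositionalEquality using (_≡_)
open import Relation.Nullary using (¬_)
open import Relation.Nullary.Decidable using (¬?)
import Relation.Binary.Construct.Flip.EqAndOrd as Flip
import Data.List.Sort.MergeSort as MS
import Data.List.Sort.Base

sumℤ : List ℤ → ℤ
sumℤ = foldr _+_ 0ℤ

Matrix : ℕ → Set
Matrix n = Fin n → Fin n → ℤ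

∑ : ∀ {n} → (Fin n → ℤ) → ℤ
∑ f = sumℤ (toList f)

nonzeros : ∀ {n} → (Fin n → ℤ) → List ℤ
nonzeros f = filter (λ x → ¬? (x Data.Integer.≟ 0ℤ)) (toList f)

data Alternating : List ℤ → Set where
  alt-[]  : Alternating []
  alt-[x] : ∀ x → Alternating (x ∷ [])
  alt-∷   : ∀ x y xs → x * y < 0ℤ → Alternating (y ∷ xs) → Alternating (x ∷ y ∷ xs)

ASMLine : ∀ {n} → (Fin n → ℤ) → Set
ASMLine f = Alternating (nonzeros f) × ∑ f ≡ 1ℤ

IsASM : ∀ {n} → Matrix n → Set
IsASM {n} A =
  (∀ i j → A i j ≡ 0ℤ ⊎ (A i j ≡ 1ℤ ⊎ A i j ≡ -1ℤ)) ×
  (∀ i → ASMLine (λ j → A i j)) ×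
  (∀ j → ASMLine (λ i → A i j))

z : (n : ℕ) → Fin n → ℤ
z n i = + (n Data.Nat.∸ toℕ i)

weightedProjection : ∀ {n} → Matrix n → Fin n → ℤ
weightedProjection {n} A j = ∑ (λ i → z n i * A i j)

module Dec = MS (Flip.decTotalOrder ℤP.≤-decTotalOrder)

sortDesc : List ℤ → List ℤ
sortDesc = Data.List.Sort.Base.SortingAlgorithm.sort Dec.mergeSort

_≼_ : ∀ {n} → Vector ℤ n → Vector ℤ n → Set
_≼_ {n} x y =
  (∀ (k : ℕ) → 1 Data.Nat.≤ k → k Data.Nat.≤ n →
     sumℤ (take k (sortDesc (toList x))) ≤ sumℤ (take k (sortDesc (toList y)))) ×
  sumℤ (toList x) ≡ sumℤ (toList y)

{-# OPTIONS --safe #-}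
module Submission where

-- The partial column sums s_r(j) = A 1 j + ⋯ + A r j of an ASM are 0 or 1 and each row of them
-- sums to r. By Abel summation v_j = Σ_r s_r(j), so any k entries of v sum to at most
-- Σ_r min(r, k), the sum of the k largest entries of z_n; over all k this is v ≼ z_n.
--
-- Conversely, v ≼ z_n is realised by a monotone triangle: starting from the row (n, …, 1), remove
-- the weights v_1, v_2, … one at a time, merging the two neighbours c₁ ≥ c₂ of the removed weight p
-- into c₁ + c₂ − p. Each new row is strictly decreasing, interlaces the previous one and still
-- majorizes the remaining weights, and the differences of the indicator vectors of consecutive rows
-- are the columns of the required ASM.

open import Defs
open import Data.Nat using (ℕ; zero; suc; z≤n; s≤s)
import Data.Nat.Properties as ℕP
open import Data.Fin using (Fin; zero; suc; toℕ)
open import Data.List using (List; []; _∷_; take; length; filter; replicate; map)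
import Data.List.Properties as ListP
open import Data.List.Relation.Unary.All using (All; []; _∷_)
open import Data.Vec.Functional using (toList)
open import Data.Product using (_×_; _,_; proj₁; proj₂; ∃)
open import Data.Sum using (_⊎_; inj₁; inj₂)
open import Data.Empty using (⊥-elim)
open import Function using (_∘_)
open import Relation.Binary.PropositionalEquality

module AlternatingLine where

  open import Data.Integer as ℤ using (ℤ; +_; _+_; _*_; 0ℤ; 1ℤ; -1ℤ; _<_)
  import Data.Integer.Properties as ℤP
  open import Data.Integer.Tactic.RingSolver using (solve-∀)
  open import Relation.Nullary.Decidable using (¬?)

  Is01 : ℤ → Set
  Is01 x = x ≡ 0ℤ ⊎ x ≡ 1ℤ

  Is0±1 : ℤ → Set
  Is0±1 x = x ≡ 0ℤ ⊎ (x ≡ 1ℤ ⊎ x ≡ -1ℤ)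

  dropZeros : List ℤ → List ℤ
  dropZeros = filter (λ x → ¬? (x ℤ.≟ 0ℤ))

  headSign : ∀ {x y xs} → Alternating (x ∷ y ∷ xs) → x * y < 0ℤ
  headSign (alt-∷ _ _ _ p _) = p

  tailAlternating : ∀ {x xs} → Alternating (x ∷ xs) → Alternating xs
  tailAlternating (alt-[x] _) = alt-[]
  tailAlternating (alt-∷ _ _ _ _ a) = a

  -1+-cancel : ∀ s → 1ℤ + (-1ℤ + s) ≡ s
  -1+-cancel = solve-∀

  -- The running sum of an alternating line is 0 or 1; a phantom leading -1 (resp. 1) in front
  -- of the nonzero entries records that it is currently 0 (resp. 1).
  mutual
    alternating⇒prefixSums01 : ∀ L → All Is0±1 L → Alternating (-1ℤ ∷ dropZeros L) →
                               ∀ r → Is01 (sumℤ (take r L))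
    alternating⇒prefixSums01 L _ _ zero = inj₁ refl
    alternating⇒prefixSums01 [] _ _ (suc r) = inj₁ refl
    alternating⇒prefixSums01 (_ ∷ L) (inj₁ refl ∷ t) a (suc r) =
      subst Is01 (sym (ℤP.+-identityˡ _)) (alternating⇒prefixSums01 L t a r)
    alternating⇒prefixSums01 (_ ∷ L) (inj₂ (inj₁ refl) ∷ t) a (suc r) =
      alternating⇒prefixSums01⁺ L t (tailAlternating a) r
    alternating⇒prefixSums01 (_ ∷ L) (inj₂ (inj₂ refl) ∷ t) a (suc r) with headSign a
    ... | ℤ.+<+ ()

    alternating⇒prefixSums01⁺ : ∀ L → All Is0±1 L → Alternating (1ℤ ∷ dropZeros L) →
                                ∀ r → Is01 (1ℤ + sumℤ (take r L))
    alternating⇒prefixSums01⁺ L _ _ zero = inj₂ refl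
    alternating⇒prefixSums01⁺ [] _ _ (suc r) = inj₂ refl
    alternating⇒prefixSums01⁺ (_ ∷ L) (inj₁ refl ∷ t) a (suc r) =
      subst Is01 (cong (_+_ 1ℤ) (sym (ℤP.+-identityˡ (sumℤ (take r L))))) (alternating⇒prefixSums01⁺ L t a r)
    alternating⇒prefixSums01⁺ (_ ∷ L) (inj₂ (inj₁ refl) ∷ t) a (suc r) with headSign a
    ... | ℤ.+<+ ()
    alternating⇒prefixSums01⁺ (_ ∷ L) (inj₂ (inj₂ refl) ∷ t) a (suc r) =
      subst Is01 (sym (-1+-cancel _)) (alternating⇒prefixSums01 L t (tailAlternating a) r)

  Is01-+0 : ∀ x → Is01 (x + 0ℤ) → Is01 x
  Is01-+0 x = subst Is01 (ℤP.+-identityʳ x)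

  Is01-1+ : ∀ x → Is01 (1ℤ + x) → x ≡ -1ℤ ⊎ x ≡ 0ℤ
  Is01-1+ (+ 0) _ = inj₂ refl
  Is01-1+ (ℤ.-[1+ 0 ]) _ = inj₁ refl
  Is01-1+ (+ suc n) (inj₁ ())
  Is01-1+ (+ suc n) (inj₂ ())
  Is01-1+ (ℤ.-[1+ suc n ]) (inj₁ ())
  Is01-1+ (ℤ.-[1+ suc n ]) (inj₂ ())

  mutual
    prefixSums01⇒alternating : ∀ L → (∀ r → Is01 (sumℤ (take r L))) → Alternating (-1ℤ ∷ dropZeros L)
    prefixSums01⇒alternating [] _ = alt-[x] _
    prefixSums01⇒alternating (x ∷ L) h with Is01-+0 x (h 1)
    ... | inj₁ refl =
      prefixSums01⇒alternating L (λ r → subst Is01 (ℤP.+-identityˡ _) (h (suc r)))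
    ... | inj₂ refl =
      alt-∷ _ _ _ ℤ.-<+ (prefixSums01⇒alternating⁺ L (λ r → h (suc r)))

    prefixSums01⇒alternating⁺ : ∀ L → (∀ r → Is01 (1ℤ + sumℤ (take r L))) → Alternating (1ℤ ∷ dropZeros L)
    prefixSums01⇒alternating⁺ [] _ = alt-[x] _
    prefixSums01⇒alternating⁺ (x ∷ L) h with Is01-1+ x (subst (λ y → Is01 (1ℤ + y)) (ℤP.+-identityʳ x) (h 1))
    ... | inj₁ refl =
      alt-∷ _ _ _ ℤ.-<+ (prefixSums01⇒alternating L (λ r → subst Is01 (-1+-cancel _) (h (suc r))))
    ... | inj₂ refl =
      prefixSums01⇒alternating⁺ L (λ r → subst Is01 (cong (_+_ 1ℤ) (ℤP.+-identityˡ (sumℤ (take r L)))) (h (suc r)))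

  asmLine⇒alternating : ∀ L → All Is0±1 L → Alternating (dropZeros L) → sumℤ L ≡ 1ℤ →
                        Alternating (-1ℤ ∷ dropZeros L)
  asmLine⇒alternating [] _ _ ()
  asmLine⇒alternating (_ ∷ L) (inj₁ refl ∷ t) a e = asmLine⇒alternating L t a (trans (sym (ℤP.+-identityˡ _)) e)
  asmLine⇒alternating (_ ∷ L) (inj₂ (inj₁ refl) ∷ t) a e = alt-∷ _ _ _ ℤ.-<+ a
  asmLine⇒alternating (_ ∷ L) (inj₂ (inj₂ refl) ∷ t) a e =
    ⊥-elim (-1+Is01≢1 (subst Is01 (cong sumℤ (ListP.take-all (length L) L ℕP.≤-refl))
                                  (alternating⇒prefixSums01 L t a (length L))) e)
    where
    -1+Is01≢1 : ∀ {s} → Is01 s → -1ℤ + s ≢ 1ℤ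
    -1+Is01≢1 (inj₁ refl) ()
    -1+Is01≢1 (inj₂ refl) ()

module FinSum where

  open import Data.Nat as ℕ using (_⊓_)
  open import Data.Integer as ℤ using (ℤ; +_; _+_; _*_; _-_; 0ℤ; 1ℤ; _≤_)
  import Data.Integer.Properties as ℤP
  open import Data.Integer.Tactic.RingSolver using (solve-∀)

  prefixSum : ∀ {n} → ℕ → (Fin n → ℤ) → ℤ
  prefixSum r f = sumℤ (take r (toList f))

  ∑-cong : ∀ {n} {f g : Fin n → ℤ} → (∀ i → f i ≡ g i) → ∑ f ≡ ∑ g
  ∑-cong {zero} _ = refl
  ∑-cong {suc n} f≗g = cong₂ _+_ (f≗g zero) (∑-cong (f≗g ∘ suc))

  ∑-const : ∀ n c → ∑ {n} (λ _ → c) ≡ + n * c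
  ∑-const zero c = refl
  ∑-const (suc n) c = trans (cong (_+_ c) (∑-const n c)) (distrib c (+ n))
    where
    distrib : ∀ c m → c + m * c ≡ (1ℤ + m) * c
    distrib = solve-∀

  ∑-zero : ∀ n → ∑ {n} (λ _ → 0ℤ) ≡ 0ℤ
  ∑-zero n = trans (∑-const n 0ℤ) (ℤP.*-zeroʳ (+ n))

  ∑-+ : ∀ {n} (f g : Fin n → ℤ) → ∑ (λ i → f i + g i) ≡ ∑ f + ∑ g
  ∑-+ {zero} f g = refl
  ∑-+ {suc n} f g =
    trans (cong (_+_ (f zero + g zero)) (∑-+ (f ∘ suc) (g ∘ suc))) (interchange (f zero) (g zero) _ _)
    where
    interchange : ∀ a b c d → (a + b) + (c + d) ≡ (a + c) + (b + d)
    interchange = solve-∀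

  ∑-minus : ∀ {n} (f g : Fin n → ℤ) → ∑ (λ i → f i - g i) ≡ ∑ f - ∑ g
  ∑-minus {zero} f g = refl
  ∑-minus {suc n} f g =
    trans (cong (_+_ (f zero - g zero)) (∑-minus (f ∘ suc) (g ∘ suc))) (interchange (f zero) (g zero) _ _)
    where
    interchange : ∀ a b c d → (a - b) + (c - d) ≡ (a + c) - (b + d)
    interchange = solve-∀

  ∑-*ˡ : ∀ {n} c (f : Fin n → ℤ) → ∑ (λ i → c * f i) ≡ c * ∑ f
  ∑-*ˡ {zero} c f = sym (ℤP.*-zeroʳ c)
  ∑-*ˡ {suc n} c f = trans (cong (_+_ (c * f zero)) (∑-*ˡ c (f ∘ suc))) (sym (ℤP.*-distribˡ-+ c _ _))

  ∑-mono-≤ : ∀ {n} {f g : Fin n → ℤ} → (∀ i → f i ≤ g i) → ∑ f ≤ ∑ g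
  ∑-mono-≤ {zero} _ = ℤP.≤-refl
  ∑-mono-≤ {suc n} f≤g = ℤP.+-mono-≤ (f≤g zero) (∑-mono-≤ (f≤g ∘ suc))

  ∑-comm : ∀ {m n} (G : Fin m → Fin n → ℤ) → ∑ (λ i → ∑ (G i)) ≡ ∑ (λ j → ∑ (λ i → G i j))
  ∑-comm {zero} {n} G = sym (∑-zero n)
  ∑-comm {suc m} G = trans (cong (_+_ (∑ (G zero))) (∑-comm (G ∘ suc))) (sym (∑-+ (G zero) _))

  prefixSum-cong : ∀ {n} r {f g : Fin n → ℤ} → (∀ i → f i ≡ g i) → prefixSum r f ≡ prefixSum r g
  prefixSum-cong r f≗g = cong (λ xs → sumℤ (take r xs)) (ListP.tabulate-cong f≗g)

  prefixSum-zero : ∀ n r → prefixSum {n} r (λ _ → 0ℤ) ≡ 0ℤ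
  prefixSum-zero n zero = refl
  prefixSum-zero zero (suc r) = refl
  prefixSum-zero (suc n) (suc r) = trans (ℤP.+-identityˡ _) (prefixSum-zero n r)

  prefixSum-+ : ∀ {n} r (f g : Fin n → ℤ) → prefixSum r (λ i → f i + g i) ≡ prefixSum r f + prefixSum r g
  prefixSum-+ zero f g = refl
  prefixSum-+ {zero} (suc r) f g = refl
  prefixSum-+ {suc n} (suc r) f g =
    trans (cong (_+_ (f zero + g zero)) (prefixSum-+ r (f ∘ suc) (g ∘ suc))) (interchange (f zero) (g zero) _ _)
    where
    interchange : ∀ a b c d → (a + b) + (c + d) ≡ (a + c) + (b + d)
    interchange = solve-∀

  prefixSum-minus : ∀ {n} r (f g : Fin n → ℤ) → prefixSum r (λ i → f i - g i) ≡ prefixSum r f - prefixSum r g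
  prefixSum-minus zero f g = refl
  prefixSum-minus {zero} (suc r) f g = refl
  prefixSum-minus {suc n} (suc r) f g =
    trans (cong (_+_ (f zero - g zero)) (prefixSum-minus r (f ∘ suc) (g ∘ suc))) (interchange (f zero) (g zero) _ _)
    where
    interchange : ∀ a b c d → (a - b) + (c - d) ≡ (a + c) - (b + d)
    interchange = solve-∀

  prefixSum-all : ∀ {n} (f : Fin n → ℤ) → prefixSum n f ≡ ∑ f
  prefixSum-all {zero} f = refl
  prefixSum-all {suc n} f = cong (_+_ (f zero)) (prefixSum-all (f ∘ suc))

  prefixSum-⊓ : ∀ {n} r (f : Fin n → ℤ) → prefixSum r f ≡ prefixSum (r ⊓ n) f
  prefixSum-⊓ zero f = refl
  prefixSum-⊓ {zero} (suc r) f = refl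
  prefixSum-⊓ {suc n} (suc r) f = cong (_+_ (f zero)) (prefixSum-⊓ r (f ∘ suc))

  prefixSum-one : ∀ n r → r ℕ.≤ n → prefixSum {n} r (λ _ → 1ℤ) ≡ + r
  prefixSum-one n zero _ = refl
  prefixSum-one (suc n) (suc r) (s≤s r≤n) = cong (_+_ 1ℤ) (prefixSum-one n r r≤n)

  prefixSum-∑ : ∀ {m n} r (B : Fin m → Fin n → ℤ) →
                prefixSum r (λ i → ∑ (B i)) ≡ ∑ (λ j → prefixSum r (λ i → B i j))
  prefixSum-∑ {n = n} zero B = sym (∑-zero n)
  prefixSum-∑ {zero} {n} (suc r) B = sym (∑-zero n)
  prefixSum-∑ {suc m} (suc r) B = trans (cong (_+_ (∑ (B zero))) (prefixSum-∑ r (B ∘ suc))) (sym (∑-+ (B zero) _))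

  -- Abel summation: the weight n - i of row i counts the prefixes 1, …, n that contain it.
  ∑-z*≡∑-prefixSum : ∀ n (f : Fin n → ℤ) → ∑ (λ i → z n i * f i) ≡ ∑ {n} (λ r → prefixSum (suc (toℕ r)) f)
  ∑-z*≡∑-prefixSum zero f = refl
  ∑-z*≡∑-prefixSum (suc n) f = begin
    + suc n * f zero + ∑ (λ i → z n i * f (suc i))
      ≡⟨ cong (_+_ (+ suc n * f zero)) (∑-z*≡∑-prefixSum n (f ∘ suc)) ⟩
    + suc n * f zero + S
      ≡⟨ regroup (f zero) (+ n) S ⟩
    (f zero + 0ℤ) + (+ n * f zero + S)
      ≡⟨ cong (_+_ (f zero + 0ℤ)) (sym (trans (∑-+ {n} (λ _ → f zero) _) (cong (_+ S) (∑-const n (f zero))))) ⟩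
    (f zero + 0ℤ) + ∑ {n} (λ r → f zero + prefixSum (suc (toℕ r)) (f ∘ suc))
      ∎
    where
    open ≡-Reasoning
    S = ∑ {n} (λ r → prefixSum (suc (toℕ r)) (f ∘ suc))
    regroup : ∀ a m s → (1ℤ + m) * a + s ≡ (a + 0ℤ) + (m * a + s)
    regroup = solve-∀

  prefixSum-telescope : ∀ {n} r (g : ℕ → ℤ) → prefixSum {n} r (λ j → g (toℕ j) - g (suc (toℕ j))) ≡ g 0 - g (r ⊓ n)
  prefixSum-telescope zero g = sym (ℤP.+-inverseʳ (g 0))
  prefixSum-telescope {zero} (suc r) g = sym (ℤP.+-inverseʳ (g 0))
  prefixSum-telescope {suc n} (suc r) g =
    trans (cong (_+_ (g 0 - g 1)) (prefixSum-telescope {n} r (g ∘ suc))) (cancel (g 0) (g 1) (g (suc (r ⊓ n))))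
    where
    cancel : ∀ a b c → (a - b) + (b - c) ≡ a - c
    cancel = solve-∀

module Selection where

  open import Data.Bool using (Bool; true; false)
  import Data.Nat as ℕ
  open import Data.Integer as ℤ using (ℤ; _+_; 0ℤ; _≤_)
  open import Data.Integer.Tactic.RingSolver using (solve-∀)
  import Data.Integer.Properties as ℤP
  open import Data.List.Relation.Binary.Permutation.Propositional using (_↭_; prep; swap; ↭-sym; ↭⇒↭ₛ)
    renaming (refl to ↭-refl; trans to ↭-trans)
  open import Data.List.Relation.Binary.Permutation.Propositional.Properties using (↭-length)
  open import Data.List.Relation.Binary.Permutation.Setoid.Properties using (foldr-commMonoid)
  open import Data.List.Relation.Binary.Pointwise using (Pointwise-≡⇒≡)
  open import Data.List.Relation.Unary.Sorted.TotalOrder.Properties using (↗↭↗⇒≋; Sorted⇒AllPairs)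
  import Data.List.Relation.Unary.AllPairs as AllPairs
  import Data.List.Relation.Unary.Linked as Linked
  import Data.List.Sort.Base as SortBase
  open import Relation.Binary.Bundles using (TotalOrder; DecTotalOrder)
  import Relation.Binary.Construct.Flip.EqAndOrd as Flip

  select : ∀ {A : Set} → List Bool → List A → List A
  select [] _ = []
  select (_ ∷ _) [] = []
  select (true ∷ bs) (x ∷ xs) = x ∷ select bs xs
  select (false ∷ bs) (x ∷ xs) = select bs xs

  select-replicate : ∀ {A : Set} k (xs : List A) → select (replicate k true) xs ≡ take k xs
  select-replicate zero xs = refl
  select-replicate (suc k) [] = refl
  select-replicate (suc k) (x ∷ xs) = cong (x ∷_) (select-replicate k xs)

  select-map : ∀ {A B : Set} (f : A → B) bs xs → select bs (map f xs) ≡ map f (select bs xs)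
  select-map f [] xs = refl
  select-map f (_ ∷ _) [] = refl
  select-map f (true ∷ bs) (x ∷ xs) = cong (f x ∷_) (select-map f bs xs)
  select-map f (false ∷ bs) (x ∷ xs) = select-map f bs xs

  length-select≤ : ∀ {A : Set} bs (xs : List A) → length (select bs xs) ℕ.≤ length xs
  length-select≤ [] xs = z≤n
  length-select≤ (_ ∷ _) [] = z≤n
  length-select≤ (true ∷ bs) (x ∷ xs) = s≤s (length-select≤ bs xs)
  length-select≤ (false ∷ bs) (x ∷ xs) = ℕP.m≤n⇒m≤1+n (length-select≤ bs xs)

  select-↭ : ∀ {A : Set} {xs ys : List A} → xs ↭ ys → ∀ bs → ∃ λ bs′ → select bs′ ys ↭ select bs xs
  select-↭ ↭-refl bs = bs , ↭-refl
  select-↭ (prep x p) [] = [] , ↭-refl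
  select-↭ (prep x p) (b ∷ bs) with select-↭ p bs
  select-↭ (prep x p) (true ∷ bs) | bs′ , q = true ∷ bs′ , prep x q
  select-↭ (prep x p) (false ∷ bs) | bs′ , q = false ∷ bs′ , q
  select-↭ (swap x y p) [] = [] , ↭-refl
  select-↭ (swap x y p) (true ∷ []) = false ∷ true ∷ [] , ↭-refl
  select-↭ (swap x y p) (false ∷ []) = [] , ↭-refl
  select-↭ (swap x y p) (b₁ ∷ b₂ ∷ bs) with select-↭ p bs
  select-↭ (swap x y p) (true ∷ true ∷ bs) | bs′ , q = true ∷ true ∷ bs′ , swap y x q
  select-↭ (swap x y p) (true ∷ false ∷ bs) | bs′ , q = false ∷ true ∷ bs′ , prep x q
  select-↭ (swap x y p) (false ∷ true ∷ bs) | bs′ , q = true ∷ false ∷ bs′ , prep y q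
  select-↭ (swap x y p) (false ∷ false ∷ bs) | bs′ , q = false ∷ false ∷ bs′ , q
  select-↭ (↭-trans p₁ p₂) bs with select-↭ p₁ bs
  ... | bs₁ , q₁ with select-↭ p₂ bs₁
  ... | bs₂ , q₂ = bs₂ , ↭-trans q₂ q₁

  sumℤ-↭ : ∀ {xs ys} → xs ↭ ys → sumℤ xs ≡ sumℤ ys
  sumℤ-↭ p = foldr-commMonoid ℤP.≡-setoid ℤP.+-0-isCommutativeMonoid (↭⇒↭ₛ p)

  ≥-totalOrder : TotalOrder _ _ _
  ≥-totalOrder = DecTotalOrder.totalOrder (Flip.decTotalOrder ℤP.≤-decTotalOrder)

  open import Data.List.Relation.Unary.Sorted.TotalOrder ≥-totalOrder using (Sorted) public

  sortDesc-↭ : ∀ xs → sortDesc xs ↭ xs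
  sortDesc-↭ = SortBase.SortingAlgorithm.sort-↭ Dec.mergeSort

  sortDesc-sorted : ∀ xs → Sorted (sortDesc xs)
  sortDesc-sorted = SortBase.SortingAlgorithm.sort-↗ Dec.mergeSort

  sortDesc-sorted-id : ∀ {xs} → Sorted xs → sortDesc xs ≡ xs
  sortDesc-sorted-id {xs} xs↗ =
    Pointwise-≡⇒≡ (↗↭↗⇒≋ ≥-totalOrder (sortDesc-sorted xs) xs↗ (↭⇒↭ₛ (sortDesc-↭ xs)))

  -- For decreasing ys this is the inequality half of majorization, phrased over all sub-lists of xs
  -- so that it is insensitive to the order of xs.
  _⊴_ : List ℤ → List ℤ → Set
  xs ⊴ ys = ∀ bs → sumℤ (select bs xs) ≤ sumℤ (take (length (select bs xs)) ys)

  sumℤ-take-suc≤ : ∀ {a} k xs → suc k ℕ.≤ length xs → All (_≤ a) xs →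
                   sumℤ (take (suc k) xs) ≤ a + sumℤ (take k xs)
  sumℤ-take-suc≤ zero (x ∷ xs) _ (x≤a ∷ _) = ℤP.+-monoˡ-≤ 0ℤ x≤a
  sumℤ-take-suc≤ {a} (suc k) (x ∷ xs) (s≤s k<∣xs∣) (_ ∷ xs≤a) =
    subst (x + sumℤ (take (suc k) xs) ≤_) (swap-heads x a (sumℤ (take k xs)))
      (ℤP.+-monoʳ-≤ x (sumℤ-take-suc≤ k xs k<∣xs∣ xs≤a))
    where
    swap-heads : ∀ x a t → x + (a + t) ≡ a + (x + t)
    swap-heads = solve-∀

  sorted⇒head-max : ∀ {x xs} → Sorted (x ∷ xs) → All (_≤ x) xs
  sorted⇒head-max x∷xs↗ = AllPairs.head (Sorted⇒AllPairs ≥-totalOrder x∷xs↗)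

  sorted⇒⊴-self : ∀ {xs} → Sorted xs → xs ⊴ xs
  sorted⇒⊴-self {xs} _ [] = ℤP.≤-refl
  sorted⇒⊴-self {[]} _ (_ ∷ _) = ℤP.≤-refl
  sorted⇒⊴-self {x ∷ xs} x∷xs↗ (true ∷ bs) = ℤP.+-monoʳ-≤ x (sorted⇒⊴-self (Linked.tail x∷xs↗) bs)
  sorted⇒⊴-self {x ∷ xs} x∷xs↗ (false ∷ bs)
    with length (select bs xs) in eq | sorted⇒⊴-self (Linked.tail x∷xs↗) bs
  ... | zero | ih = ih
  ... | suc k | ih = ℤP.≤-trans ih
    (sumℤ-take-suc≤ k xs (subst (ℕ._≤ length xs) eq (length-select≤ bs xs)) (sorted⇒head-max x∷xs↗))

  length-sortDesc : ∀ {n} (v : Fin n → ℤ) → length (sortDesc (toList v)) ≡ n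
  length-sortDesc v = trans (↭-length (sortDesc-↭ (toList v))) (ListP.length-tabulate v)

  length-take-≤ : ∀ {A : Set} k (xs : List A) → k ℕ.≤ length xs → length (take k xs) ≡ k
  length-take-≤ k xs k≤∣xs∣ = trans (ListP.length-take k xs) (ℕP.m≤n⇒m⊓n≡m k≤∣xs∣)

  module _ {n} (v w : Fin n → ℤ) (w↗ : Sorted (toList w)) where

    private
      vs = toList v
      ws = toList w

      prefix-as-selection : ∀ k → k ℕ.≤ n →
        ∃ λ bs → sumℤ (take k (sortDesc vs)) ≡ sumℤ (select bs vs) × length (select bs vs) ≡ k
      prefix-as-selection k k≤n with select-↭ (sortDesc-↭ vs) (replicate k true)
      ... | bs , p = bs , sumℤ-↭ prefix↭ , trans (↭-length (↭-sym prefix↭))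
                                              (length-take-≤ k _ (subst (k ℕ.≤_) (sym (length-sortDesc v)) k≤n))
        where
        prefix↭ : take k (sortDesc vs) ↭ select bs vs
        prefix↭ = subst (_↭ select bs vs) (select-replicate k (sortDesc vs)) (↭-sym p)

    ⊴⇒≼ : vs ⊴ ws → sumℤ vs ≡ sumℤ ws → v ≼ w
    ⊴⇒≼ vs⊴ws total = prefixes , total
      where
      open ℤP.≤-Reasoning
      prefixes : ∀ k → 1 ℕ.≤ k → k ℕ.≤ n → sumℤ (take k (sortDesc vs)) ≤ sumℤ (take k (sortDesc ws))
      prefixes k _ k≤n with prefix-as-selection k k≤n
      ... | bs , same-sum , same-length = begin
        sumℤ (take k (sortDesc vs))                     ≡⟨ same-sum ⟩
        sumℤ (select bs vs)                             ≤⟨ vs⊴ws bs ⟩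
        sumℤ (take (length (select bs vs)) ws)          ≡⟨ cong (λ j → sumℤ (take j ws)) same-length ⟩
        sumℤ (take k ws)                                ≡⟨ cong (λ xs → sumℤ (take k xs)) (sortDesc-sorted-id w↗) ⟨
        sumℤ (take k (sortDesc ws))                     ∎

    ≼⇒⊴ : v ≼ w → vs ⊴ ws
    ≼⇒⊴ (prefixes , _) bs with select-↭ (↭-sym (sortDesc-↭ vs)) bs
    ... | bs′ , p = begin
      sumℤ (select bs vs)                                            ≡⟨ sumℤ-↭ p ⟨
      sumℤ (select bs′ (sortDesc vs))                                ≤⟨ sorted⇒⊴-self (sortDesc-sorted vs) bs′ ⟩
      sumℤ (take (length (select bs′ (sortDesc vs))) (sortDesc vs))
        ≡⟨ cong (λ j → sumℤ (take j (sortDesc vs))) (↭-length p) ⟩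
      sumℤ (take k (sortDesc vs))                                    ≤⟨ prefixes₀ k k≤n ⟩
      sumℤ (take k (sortDesc ws))                                    ≡⟨ cong (λ xs → sumℤ (take k xs)) (sortDesc-sorted-id w↗) ⟩
      sumℤ (take k ws)                                               ∎
      where
      open ℤP.≤-Reasoning
      k = length (select bs vs)
      k≤n : k ℕ.≤ n
      k≤n = subst (k ℕ.≤_) (ListP.length-tabulate v) (length-select≤ bs vs)
      prefixes₀ : ∀ k → k ℕ.≤ n → sumℤ (take k (sortDesc vs)) ≤ sumℤ (take k (sortDesc ws))
      prefixes₀ zero _ = ℤP.≤-refl
      prefixes₀ (suc k) = prefixes (suc k) (s≤s z≤n)

  z-sorted : ∀ n → Sorted (toList (z n))
  z-sorted zero = Linked.[]
  z-sorted (suc zero) = Linked.[-]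
  z-sorted (suc (suc n)) = ℤ.+≤+ (ℕP.n≤1+n (suc n)) Linked.∷ z-sorted (suc n)

module Necessity where

  open import Data.Bool using (Bool; true; false)
  open import Data.Nat as ℕ using (_⊓_)
  open import Data.Integer as ℤ using (ℤ; +_; _+_; _*_; 0ℤ; 1ℤ; _≤_)
  import Data.Integer.Properties as ℤP
  import Data.Fin.Properties as FinP
  open import Data.List.Relation.Unary.All.Properties using (tabulate⁺)
  open AlternatingLine
  open FinSum
  open Selection

  indicator : ∀ {n} → List Bool → Fin n → ℤ
  indicator [] _ = 0ℤ
  indicator (_ ∷ bs) (suc j) = indicator bs j
  indicator (true ∷ _) zero = 1ℤ
  indicator (false ∷ _) zero = 0ℤ

  indicator-01 : ∀ {n} bs (j : Fin n) → Is01 (indicator bs j)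
  indicator-01 [] j = inj₁ refl
  indicator-01 (_ ∷ bs) (suc j) = indicator-01 bs j
  indicator-01 (true ∷ bs) zero = inj₂ refl
  indicator-01 (false ∷ bs) zero = inj₁ refl

  sumℤ-select : ∀ {n} bs (f : Fin n → ℤ) → sumℤ (select bs (toList f)) ≡ ∑ (λ j → indicator bs j * f j)
  sumℤ-select {zero} [] f = refl
  sumℤ-select {suc n} [] f = sym (∑-zero (suc n))
  sumℤ-select {zero} (_ ∷ _) f = refl
  sumℤ-select {suc n} (true ∷ bs) f = cong₂ _+_ (sym (ℤP.*-identityˡ (f zero))) (sumℤ-select bs (f ∘ suc))
  sumℤ-select {suc n} (false ∷ bs) f = trans (sumℤ-select bs (f ∘ suc)) (sym (ℤP.+-identityˡ _))

  length-select : ∀ {n} bs (f : Fin n → ℤ) → + length (select bs (toList f)) ≡ ∑ (indicator {n} bs)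
  length-select {zero} [] f = refl
  length-select {suc n} [] f = sym (∑-zero (suc n))
  length-select {zero} (_ ∷ _) f = refl
  length-select {suc n} (true ∷ bs) f = cong (_+_ 1ℤ) (length-select bs (f ∘ suc))
  length-select {suc n} (false ∷ bs) f = trans (length-select bs (f ∘ suc)) (sym (ℤP.+-identityˡ _))

  *-01-≤ʳ : ∀ {a c} → Is01 a → Is01 c → a * c ≤ c
  *-01-≤ʳ (inj₁ refl) (inj₁ refl) = ℤP.≤-refl
  *-01-≤ʳ (inj₁ refl) (inj₂ refl) = ℤ.+≤+ z≤n
  *-01-≤ʳ (inj₂ refl) (inj₁ refl) = ℤP.≤-refl
  *-01-≤ʳ (inj₂ refl) (inj₂ refl) = ℤP.≤-refl

  *-01-≤ˡ : ∀ {a c} → Is01 a → Is01 c → a * c ≤ a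
  *-01-≤ˡ {a} {c} a01 c01 = subst (_≤ a) (ℤP.*-comm c a) (*-01-≤ʳ c01 a01)

  ∑-⊓≡sum-take-z : ∀ n k → ∑ {n} (λ r → + (suc (toℕ r) ⊓ k)) ≡ sumℤ (take k (toList (z n)))
  ∑-⊓≡sum-take-z n zero = ∑-zero n
  ∑-⊓≡sum-take-z zero (suc k) = refl
  ∑-⊓≡sum-take-z (suc n) (suc k) = begin
    1ℤ + ∑ {n} (λ r → 1ℤ + M r)          ≡⟨ cong (_+_ 1ℤ) (∑-+ (λ _ → 1ℤ) M) ⟩
    1ℤ + (∑ {n} (λ _ → 1ℤ) + ∑ M)        ≡⟨ cong (λ c → 1ℤ + (c + ∑ M)) (trans (∑-const n 1ℤ) (ℤP.*-identityʳ (+ n))) ⟩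
    1ℤ + (+ n + ∑ M)                     ≡⟨ ℤP.+-assoc 1ℤ (+ n) (∑ M) ⟨
    + suc n + ∑ M                        ≡⟨ cong (_+_ (+ suc n)) (∑-⊓≡sum-take-z n k) ⟩
    + suc n + sumℤ (take k (toList (z n))) ∎
    where
    open ≡-Reasoning
    M : Fin n → ℤ
    M r = + (suc (toℕ r) ⊓ k)

  module _ {n} (A : Matrix n) (asm : IsASM A) where

    private
      entries = proj₁ asm
      rows = proj₁ (proj₂ asm)
      columns = proj₂ (proj₂ asm)

      column : Fin n → Fin n → ℤ
      column j i = A i j

      columnPrefix : ℕ → Fin n → ℤ
      columnPrefix r j = prefixSum r (column j)

      columnPrefix-01 : ∀ r j → Is01 (columnPrefix r j)
      columnPrefix-01 r j =
        alternating⇒prefixSums01 (toList (column j)) entries-j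
          (asmLine⇒alternating (toList (column j)) entries-j (proj₁ (columns j)) (proj₂ (columns j))) r
        where entries-j = tabulate⁺ (λ i → entries i j)

      ∑-columnPrefix : ∀ r → r ℕ.≤ n → ∑ (columnPrefix r) ≡ + r
      ∑-columnPrefix r r≤n = begin
        ∑ (columnPrefix r)                         ≡⟨ prefixSum-∑ r A ⟨
        prefixSum r (λ i → ∑ (A i))                ≡⟨ prefixSum-cong r (λ i → proj₂ (rows i)) ⟩
        prefixSum r (λ _ → 1ℤ)                     ≡⟨ prefixSum-one n r r≤n ⟩
        + r                                        ∎
        where open ≡-Reasoning

      wp≡∑-columnPrefix : ∀ j → weightedProjection A j ≡ ∑ {n} (λ r → columnPrefix (suc (toℕ r)) j)
      wp≡∑-columnPrefix j = ∑-z*≡∑-prefixSum n (column j)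

      s : Fin n → Fin n → ℤ
      s r = columnPrefix (suc (toℕ r))

      ∣select∣ : List Bool → ℕ
      ∣select∣ bs = length (select bs (toList (weightedProjection A)))

      selected-prefix≤ : ∀ bs r → ∑ (λ j → indicator bs j * s r j) ≤ + (suc (toℕ r) ⊓ ∣select∣ bs)
      selected-prefix≤ bs r = ℤP.⊓-glb {y = + suc (toℕ r)} {z = + ∣select∣ bs}
        (ℤP.≤-trans (∑-mono-≤ (λ j → *-01-≤ʳ (indicator-01 bs j) (columnPrefix-01 (suc (toℕ r)) j)))
                    (ℤP.≤-reflexive (∑-columnPrefix (suc (toℕ r)) (FinP.toℕ<n r))))
        (ℤP.≤-trans (∑-mono-≤ (λ j → *-01-≤ˡ (indicator-01 bs j) (columnPrefix-01 (suc (toℕ r)) j)))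
                    (ℤP.≤-reflexive (sym (length-select bs (weightedProjection A)))))

    wp⊴z : toList (weightedProjection A) ⊴ toList (z n)
    wp⊴z bs = begin
      sumℤ (select bs (toList wp))                          ≡⟨ sumℤ-select bs wp ⟩
      ∑ (λ j → indicator bs j * wp j)
        ≡⟨ ∑-cong (λ j → cong (_*_ (indicator bs j)) (wp≡∑-columnPrefix j)) ⟩
      ∑ (λ j → indicator bs j * ∑ (λ r → s r j))            ≡⟨ ∑-cong (λ j → ∑-*ˡ (indicator bs j) (λ r → s r j)) ⟨
      ∑ (λ j → ∑ (λ r → indicator bs j * s r j))            ≡⟨ ∑-comm (λ j r → indicator bs j * s r j) ⟩
      ∑ (λ r → ∑ (λ j → indicator bs j * s r j))            ≤⟨ ∑-mono-≤ (selected-prefix≤ bs) ⟩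
      ∑ {n} (λ r → + (suc (toℕ r) ⊓ k))                     ≡⟨ ∑-⊓≡sum-take-z n k ⟩
      sumℤ (take k (toList (z n)))                          ∎
      where
      open ℤP.≤-Reasoning
      wp = weightedProjection A
      k = length (select bs (toList wp))

    sum-wp≡sum-z : sumℤ (toList (weightedProjection A)) ≡ sumℤ (toList (z n))
    sum-wp≡sum-z = begin
      ∑ (weightedProjection A)                             ≡⟨ ∑-cong wp≡∑-columnPrefix ⟩
      ∑ (λ j → ∑ (λ r → s r j))                            ≡⟨ ∑-comm (λ j r → s r j) ⟩
      ∑ (λ r → ∑ (s r))                                    ≡⟨ ∑-cong (λ r → ∑-columnPrefix (suc (toℕ r)) (FinP.toℕ<n r)) ⟩
      ∑ {n} (λ r → + suc (toℕ r))                          ≡⟨ ∑-cong {n} (λ r → cong +_ (ℕP.m≤n⇒m⊓n≡m (FinP.toℕ<n r))) ⟨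
      ∑ {n} (λ r → + (suc (toℕ r) ⊓ n))                    ≡⟨ ∑-⊓≡sum-take-z n n ⟩
      prefixSum n (z n)                                    ≡⟨ prefixSum-all (z n) ⟩
      ∑ (z n)                                              ∎
      where open ≡-Reasoning

    asm⇒≼z : ∀ {v} → (∀ j → weightedProjection A j ≡ v j) → v ≼ z n
    asm⇒≼z {v} wp≡v =
      ⊴⇒≼ v (z n) (z-sorted n) (subst (_⊴ toList (z n)) wp≡v′ wp⊴z) (trans (cong sumℤ (sym wp≡v′)) sum-wp≡sum-z)
      where
      wp≡v′ : toList (weightedProjection A) ≡ toList v
      wp≡v′ = ListP.tabulate-cong wp≡v

module MonotoneTriangle where

  open import Data.Nat using (_+_; _∸_; _≤_; _<_; _>_; _<ᵇ_; _≤ᵇ_; _≡ᵇ_)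
  open import Data.Nat.ListAction using (sum)
  open import Data.List.Relation.Unary.Linked as Linked using (Linked; []; [-]; _∷_)
  import Data.List.Relation.Unary.AllPairs as AllPairs
  open import Data.List.Relation.Unary.Linked.Properties using (Linked⇒AllPairs)
  open import Data.Nat.Tactic.RingSolver using (solve-∀)
  open import Relation.Nullary.Reflects using (Reflects; ofʸ; ofⁿ; fromEquivalence)
  open import Data.Bool using (Bool; true; false; if_then_else_)
  open Selection using (select; select-replicate)

  nextRow : List ℕ → ℕ → List ℕ
  nextRow [] p = []
  nextRow (c₁ ∷ []) p = []
  nextRow (c₁ ∷ c₂ ∷ c) p = if p <ᵇ c₂ then c₁ ∷ nextRow (c₂ ∷ c) p else (c₁ + c₂ ∸ p) ∷ c

  -- The last entry of c is at most p.
  LastAtMost : List ℕ → ℕ → Set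
  LastAtMost c p = sum c ≤ p + sum (take (length c ∸ 1) c)

  LastAtMost-tail : ∀ c₁ c₂ c {p} → LastAtMost (c₁ ∷ c₂ ∷ c) p → LastAtMost (c₂ ∷ c) p
  LastAtMost-tail c₁ c₂ c {p} last≤p =
    ℕP.+-cancelˡ-≤ c₁ _ _ (subst (c₁ + sum (c₂ ∷ c) ≤_) (swap-heads p c₁ _) last≤p)
    where
    swap-heads : ∀ a b c → a + (b + c) ≡ b + (a + c)
    swap-heads = solve-∀

  merged+p : ∀ c₁ c₂ {p} → p ≤ c₁ → (c₁ + c₂ ∸ p) + p ≡ c₁ + c₂
  merged+p c₁ c₂ p≤c₁ = ℕP.m∸n+n≡m (ℕP.≤-trans p≤c₁ (ℕP.m≤m+n c₁ c₂))

  merged≤ : ∀ c₁ c₂ {p} → c₂ ≤ p → c₁ + c₂ ∸ p ≤ c₁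
  merged≤ c₁ c₂ c₂≤p = ℕP.≤-trans (ℕP.∸-monoʳ-≤ (c₁ + c₂) c₂≤p) (ℕP.≤-reflexive (ℕP.m+n∸n≡m c₁ c₂))

  ≤merged : ∀ c₁ c₂ {p} → p ≤ c₁ → c₂ ≤ c₁ + c₂ ∸ p
  ≤merged c₁ c₂ p≤c₁ = ℕP.≤-trans (ℕP.≤-reflexive (sym (ℕP.m+n∸m≡n c₁ c₂))) (ℕP.∸-monoʳ-≤ (c₁ + c₂) p≤c₁)

  nextRow-length : ∀ c₁ c p → length (nextRow (c₁ ∷ c) p) ≡ length c
  nextRow-length c₁ [] p = refl
  nextRow-length c₁ (c₂ ∷ c) p with p <ᵇ c₂
  ... | true = cong suc (nextRow-length c₂ c p)
  ... | false = refl

  nextRow-sum : ∀ c₁ c {p} → p ≤ c₁ → LastAtMost (c₁ ∷ c) p → sum (nextRow (c₁ ∷ c) p) + p ≡ sum (c₁ ∷ c)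
  nextRow-sum c₁ [] p≤c₁ last≤p =
    ℕP.≤-antisym (ℕP.≤-trans p≤c₁ (ℕP.m≤m+n c₁ 0)) (ℕP.≤-trans last≤p (ℕP.≤-reflexive (ℕP.+-identityʳ _)))
  nextRow-sum c₁ (c₂ ∷ c) {p} p≤c₁ last≤p with p <ᵇ c₂ | ℕP.<ᵇ-reflects-< p c₂
  ... | true | ofʸ p<c₂ = trans (ℕP.+-assoc c₁ _ p)
                     (cong (c₁ +_) (nextRow-sum c₂ c (ℕP.<⇒≤ p<c₂) (LastAtMost-tail c₁ c₂ c last≤p)))
  ... | false | _ = trans (right-comm (c₁ + c₂ ∸ p) (sum c) p)
                 (trans (cong (_+ sum c) (merged+p c₁ c₂ p≤c₁)) (ℕP.+-assoc c₁ c₂ (sum c)))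
    where
    right-comm : ∀ a b c → a + b + c ≡ a + c + b
    right-comm = solve-∀

  nextRow-prefix : ∀ c₁ c {p} → p ≤ c₁ → LastAtMost (c₁ ∷ c) p → ∀ k →
    sum (take k (c₁ ∷ c)) ≤ sum (take k (nextRow (c₁ ∷ c) p)) ⊎
    sum (take (suc k) (c₁ ∷ c)) ≤ p + sum (take k (nextRow (c₁ ∷ c) p))
  nextRow-prefix c₁ c p≤c₁ last≤p zero = inj₁ ℕP.≤-refl
  nextRow-prefix c₁ [] p≤c₁ last≤p (suc k) = inj₂ last≤p
  nextRow-prefix c₁ (c₂ ∷ c) {p} p≤c₁ last≤p (suc k) with p <ᵇ c₂ | ℕP.<ᵇ-reflects-< p c₂
  ... | true | ofʸ p<c₂ with nextRow-prefix c₂ c (ℕP.<⇒≤ p<c₂) (LastAtMost-tail c₁ c₂ c last≤p) k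
  ...   | inj₁ q = inj₁ (ℕP.+-monoʳ-≤ c₁ q)
  ...   | inj₂ q = inj₂ (subst (c₁ + sum (take (suc k) (c₂ ∷ c)) ≤_) (swap-heads c₁ p _) (ℕP.+-monoʳ-≤ c₁ q))
    where
    swap-heads : ∀ a b c → a + (b + c) ≡ b + (a + c)
    swap-heads = solve-∀
  nextRow-prefix c₁ (c₂ ∷ c) {p} p≤c₁ last≤p (suc k) | false | _ = inj₂ (ℕP.≤-reflexive (begin
    c₁ + (c₂ + sum (take k c))             ≡⟨ ℕP.+-assoc c₁ c₂ _ ⟨
    c₁ + c₂ + sum (take k c)               ≡⟨ cong (_+ sum (take k c)) (merged+p c₁ c₂ p≤c₁) ⟨
    (c₁ + c₂ ∸ p) + p + sum (take k c)     ≡⟨ cong (_+ sum (take k c)) (ℕP.+-comm _ p) ⟩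
    p + (c₁ + c₂ ∸ p) + sum (take k c)     ≡⟨ ℕP.+-assoc p _ _ ⟩
    p + ((c₁ + c₂ ∸ p) + sum (take k c))   ∎))
    where open ≡-Reasoning

  record Majorized (w c : List ℕ) : Set where
    field
      sum≡ : sum c ≡ sum w
      selection≤ : ∀ bs → sum (select bs w) ≤ sum (take (length (select bs w)) c)
      length≡ : length c ≡ length w
  open Majorized

  Majorized-head≤ : ∀ {p w c₁ c} → Majorized (p ∷ w) (c₁ ∷ c) → p ≤ c₁
  Majorized-head≤ {p} {c₁ = c₁} maj = subst₂ _≤_ (ℕP.+-identityʳ p) (ℕP.+-identityʳ c₁) (selection≤ maj (true ∷ []))

  Majorized-lastAtMost : ∀ {p w c₁ c} → Majorized (p ∷ w) (c₁ ∷ c) → LastAtMost (c₁ ∷ c) p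
  Majorized-lastAtMost {p} {w} {c₁} {c} maj =
    subst (_≤ p + sum (take (length c) (c₁ ∷ c))) (sym (sum≡ maj))
      (ℕP.+-monoʳ-≤ p (subst₂ (λ xs k → sum xs ≤ sum (take k (c₁ ∷ c)))
                               select-all (trans (cong length select-all) |w|≡|c|)
        (selection≤ maj (false ∷ replicate (length w) true))))
    where
    select-all : select (replicate (length w) true) w ≡ w
    select-all = trans (select-replicate (length w) w) (ListP.take-all (length w) w ℕP.≤-refl)
    |w|≡|c| : length w ≡ length c
    |w|≡|c| = sym (ℕP.suc-injective (length≡ maj))

  Majorized-nextRow : ∀ {p w} c → Majorized (p ∷ w) c → Majorized w (nextRow c p)
  Majorized-nextRow [] maj with length≡ maj
  ... | ()
  Majorized-nextRow {p} {w} (c₁ ∷ c) maj = record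
    { sum≡ = ℕP.+-cancelʳ-≡ p _ _ (trans (nextRow-sum c₁ c p≤c₁ last≤p) (trans (sum≡ maj) (ℕP.+-comm p (sum w))))
    ; selection≤ = selection≤′
    ; length≡ = trans (nextRow-length c₁ c p) (ℕP.suc-injective (length≡ maj))
    }
    where
    p≤c₁ = Majorized-head≤ maj
    last≤p = Majorized-lastAtMost maj
    selection≤′ : ∀ bs → sum (select bs w) ≤ sum (take (length (select bs w)) (nextRow (c₁ ∷ c) p))
    selection≤′ bs with nextRow-prefix c₁ c p≤c₁ last≤p (length (select bs w))
    ... | inj₁ q = ℕP.≤-trans (selection≤ maj (false ∷ bs)) q
    ... | inj₂ q = ℕP.+-cancelˡ-≤ p _ _ (ℕP.≤-trans (selection≤ maj (true ∷ bs)) q)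

  Decreasing : List ℕ → Set
  Decreasing = Linked _>_

  Decreasing⇒head-max : ∀ {t c} → Decreasing (t ∷ c) → All (_< t) c
  Decreasing⇒head-max t∷c↓ = AllPairs.head (Linked⇒AllPairs (λ x>y y>z → ℕP.<-trans y>z x>y) t∷c↓)

  Decreasing-raiseHead : ∀ {x c₂ c} → c₂ ≤ x → Decreasing (c₂ ∷ c) → Decreasing (x ∷ c)
  Decreasing-raiseHead {c = []} _ _ = [-]
  Decreasing-raiseHead {c = _ ∷ _} c₂≤x (c₂>c₃ ∷ c↓) = ℕP.<-≤-trans c₂>c₃ c₂≤x ∷ c↓

  Decreasing-nextRow-cons : ∀ a c₂ c {p} → p ≤ c₂ → Decreasing (a ∷ c₂ ∷ c) → Decreasing (a ∷ nextRow (c₂ ∷ c) p)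
  Decreasing-nextRow-cons a c₂ [] _ _ = [-]
  Decreasing-nextRow-cons a c₂ (c₃ ∷ c) {p} p≤c₂ (a>c₂ ∷ c↓) with p <ᵇ c₃ | ℕP.<ᵇ-reflects-< p c₃
  ... | true | ofʸ p<c₃ = a>c₂ ∷ Decreasing-nextRow-cons c₂ c₃ c (ℕP.<⇒≤ p<c₃) c↓
  ... | false | ofⁿ p≮c₃ =
    ℕP.≤-<-trans (merged≤ c₂ c₃ (ℕP.≮⇒≥ p≮c₃)) a>c₂ ∷ Decreasing-raiseHead (≤merged c₂ c₃ p≤c₂) (Linked.tail c↓)

  nextRow-decreasing : ∀ c₁ c {p} → p ≤ c₁ → Decreasing (c₁ ∷ c) → Decreasing (nextRow (c₁ ∷ c) p)
  nextRow-decreasing c₁ [] _ _ = []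
  nextRow-decreasing c₁ (c₂ ∷ c) {p} p≤c₁ c↓ with p <ᵇ c₂ | ℕP.<ᵇ-reflects-< p c₂
  ... | true | ofʸ p<c₂ = Decreasing-nextRow-cons c₁ c₂ c (ℕP.<⇒≤ p<c₂) c↓
  ... | false | _ = Decreasing-raiseHead (≤merged c₁ c₂ p≤c₁) (Linked.tail c↓)

  InRange : ℕ → ℕ → Set
  InRange n t = 1 ≤ t × t ≤ n

  nextRow-inRange : ∀ {n} c₁ c {p} → p ≤ c₁ → All (InRange n) (c₁ ∷ c) → All (InRange n) (nextRow (c₁ ∷ c) p)
  nextRow-inRange c₁ [] _ _ = []
  nextRow-inRange c₁ (c₂ ∷ c) {p} p≤c₁ (r₁ ∷ r₂ ∷ rs) with p <ᵇ c₂ | ℕP.<ᵇ-reflects-< p c₂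
  ... | true | ofʸ p<c₂ = r₁ ∷ nextRow-inRange c₂ c (ℕP.<⇒≤ p<c₂) (r₂ ∷ rs)
  ... | false | ofⁿ p≮c₂ =
    (ℕP.≤-trans (proj₁ r₂) (≤merged c₁ c₂ p≤c₁) , ℕP.≤-trans (merged≤ c₁ c₂ (ℕP.≮⇒≥ p≮c₂)) (proj₂ r₁)) ∷ rs

  𝟙 : Bool → ℕ
  𝟙 b = if b then 1 else 0

  𝟙-≤ᵇ : ∀ {u t} → u ≤ t → 𝟙 (u ≤ᵇ t) ≡ 1
  𝟙-≤ᵇ {u} {t} u≤t with u ≤ᵇ t | ℕP.≤ᵇ-reflects-≤ u t
  ... | true | _ = refl
  ... | false | ofⁿ u≰t = ⊥-elim (u≰t u≤t)

  𝟙-≰ᵇ : ∀ {u t} → t < u → 𝟙 (u ≤ᵇ t) ≡ 0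
  𝟙-≰ᵇ {u} {t} t<u with u ≤ᵇ t | ℕP.≤ᵇ-reflects-≤ u t
  ... | true | ofʸ u≤t = ⊥-elim (ℕP.<⇒≱ t<u u≤t)
  ... | false | _ = refl

  ≡ᵇ-reflects-≡ : ∀ m n → Reflects (m ≡ n) (m ≡ᵇ n)
  ≡ᵇ-reflects-≡ m n = fromEquivalence (ℕP.≡ᵇ⇒≡ m n) (ℕP.≡⇒≡ᵇ m n)

  𝟙-≡ᵇ : ∀ {u t} → u ≡ t → 𝟙 (u ≡ᵇ t) ≡ 1
  𝟙-≡ᵇ {u} {t} u≡t with u ≡ᵇ t | ≡ᵇ-reflects-≡ u t
  ... | true | _ = refl
  ... | false | ofⁿ u≢t = ⊥-elim (u≢t u≡t)

  𝟙-≢ᵇ : ∀ {u t} → u ≢ t → 𝟙 (u ≡ᵇ t) ≡ 0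
  𝟙-≢ᵇ {u} {t} u≢t with u ≡ᵇ t | ≡ᵇ-reflects-≡ u t
  ... | true | ofʸ u≡t = ⊥-elim (u≢t u≡t)
  ... | false | _ = refl

  count≥ : ℕ → List ℕ → ℕ
  count≥ u [] = 0
  count≥ u (t ∷ c) = 𝟙 (u ≤ᵇ t) + count≥ u c

  count≥-1 : ∀ c → All (1 ≤_) c → count≥ 1 c ≡ length c
  count≥-1 [] _ = refl
  count≥-1 (t ∷ c) (1≤t ∷ c≥1) = cong₂ _+_ (𝟙-≤ᵇ 1≤t) (count≥-1 c c≥1)

  -- Counting form of d interlacing c, i.e. c₁ ≥ d₁ ≥ c₂ ≥ d₂ ≥ ⋯
  Interlaces : List ℕ → List ℕ → Set
  Interlaces c d = ∀ u → count≥ u c ≡ count≥ u d ⊎ count≥ u c ≡ suc (count≥ u d)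

  Interlaces-cons : ∀ t {c d} → Interlaces c d → Interlaces (t ∷ c) (t ∷ d)
  Interlaces-cons t c⋈d u with u ≤ᵇ t | c⋈d u
  ... | true | inj₁ e = inj₁ (cong suc e)
  ... | true | inj₂ e = inj₂ (cong suc e)
  ... | false | q = q

  Interlaces-merge : ∀ a b m c → b ≤ m → m ≤ a → Interlaces (a ∷ b ∷ c) (m ∷ c)
  Interlaces-merge a b m c b≤m m≤a u
    with u ≤ᵇ a | ℕP.≤ᵇ-reflects-≤ u a | u ≤ᵇ b | ℕP.≤ᵇ-reflects-≤ u b | u ≤ᵇ m | ℕP.≤ᵇ-reflects-≤ u m
  ... | true  | _       | true  | _       | true  | _       = inj₂ refl
  ... | true  | _       | false | _       | true  | _       = inj₁ refl
  ... | true  | _       | false | _       | false | _       = inj₂ refl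
  ... | false | _       | false | _       | false | _       = inj₁ refl
  ... | _     | _       | true  | ofʸ u≤b | false | ofⁿ u≰m = ⊥-elim (u≰m (ℕP.≤-trans u≤b b≤m))
  ... | false | ofⁿ u≰a | _     | _       | true  | ofʸ u≤m = ⊥-elim (u≰a (ℕP.≤-trans u≤m m≤a))

  nextRow-interlaces : ∀ c₁ c {p} → p ≤ c₁ → Interlaces (c₁ ∷ c) (nextRow (c₁ ∷ c) p)
  nextRow-interlaces c₁ [] _ u with u ≤ᵇ c₁
  ... | true = inj₂ refl
  ... | false = inj₁ refl
  nextRow-interlaces c₁ (c₂ ∷ c) {p} p≤c₁ with p <ᵇ c₂ | ℕP.<ᵇ-reflects-< p c₂
  ... | true | ofʸ p<c₂ = Interlaces-cons c₁ {c₂ ∷ c} {nextRow (c₂ ∷ c) p} (nextRow-interlaces c₂ c (ℕP.<⇒≤ p<c₂))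
  ... | false | ofⁿ p≮c₂ = Interlaces-merge c₁ c₂ (c₁ + c₂ ∸ p) c (≤merged c₁ c₂ p≤c₁) (merged≤ c₁ c₂ (ℕP.≮⇒≥ p≮c₂))

  rows : ∀ {m} → List ℕ → (Fin m → ℕ) → ℕ → List ℕ
  rows c w zero = c
  rows {zero} c w (suc j) = []
  rows {suc m} c w (suc j) = rows (nextRow c (w zero)) (w ∘ suc) j

  GoodRow : ℕ → List ℕ → Set
  GoodRow n c = Decreasing c × All (InRange n) c

  rows-good : ∀ {n m} c (w : Fin m → ℕ) → Majorized (toList w) c → GoodRow n c → ∀ j → GoodRow n (rows c w j)
  rows-good c w maj good zero = good
  rows-good {m = zero} c w maj good (suc j) = [] , []
  rows-good {m = suc m} [] w maj good (suc j) with length≡ maj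
  ... | ()
  rows-good {m = suc m} (c₁ ∷ c) w maj (c↓ , c∈) (suc j) =
    rows-good (nextRow (c₁ ∷ c) (w zero)) (w ∘ suc) (Majorized-nextRow (c₁ ∷ c) maj)
      (nextRow-decreasing c₁ c p≤c₁ c↓ , nextRow-inRange c₁ c p≤c₁ c∈) j
    where p≤c₁ = Majorized-head≤ maj

  rows-step : ∀ {m} c (w : Fin m → ℕ) → Majorized (toList w) c → ∀ (j : Fin m) →
    sum (rows c w (toℕ j)) ≡ w j + sum (rows c w (suc (toℕ j))) ×
    Interlaces (rows c w (toℕ j)) (rows c w (suc (toℕ j)))
  rows-step [] w maj zero with length≡ maj
  ... | ()
  rows-step (c₁ ∷ c) w maj zero =
    trans (sym (nextRow-sum c₁ c p≤c₁ (Majorized-lastAtMost maj))) (ℕP.+-comm _ (w zero)) ,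
    nextRow-interlaces c₁ c p≤c₁
    where p≤c₁ = Majorized-head≤ maj
  rows-step c w maj (suc j) = rows-step (nextRow c (w zero)) (w ∘ suc) (Majorized-nextRow c maj) j

  rows-length : ∀ {m} c (w : Fin m → ℕ) → Majorized (toList w) c → ∀ j → j ≤ m → length (rows c w j) ≡ length c ∸ j
  rows-length c w maj zero _ = refl
  rows-length {suc m} c w maj (suc j) (s≤s j≤m) = begin
    length (rows (nextRow c (w zero)) (w ∘ suc) j)   ≡⟨ rows-length _ (w ∘ suc) (Majorized-nextRow c maj) j j≤m ⟩
    length (nextRow c (w zero)) ∸ j                  ≡⟨ cong (_∸ j) (trans (length≡ (Majorized-nextRow c maj)) |w|≡|c|) ⟩
    length c ∸ 1 ∸ j                                 ≡⟨ ℕP.∸-+-assoc (length c) 1 j ⟩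
    length c ∸ suc j                                 ∎
    where
    open ≡-Reasoning
    |w|≡|c| : length (toList (w ∘ suc)) ≡ length c ∸ 1
    |w|≡|c| = cong (_∸ 1) (sym (length≡ maj))

  multiplicity : ℕ → List ℕ → ℕ
  multiplicity u [] = 0
  multiplicity u (t ∷ c) = 𝟙 (u ≡ᵇ t) + multiplicity u c

  multiplicity-absent : ∀ {u} c → All (_< u) c → multiplicity u c ≡ 0
  multiplicity-absent [] _ = refl
  multiplicity-absent (t ∷ c) (t<u ∷ c<u) =
    cong₂ _+_ (𝟙-≢ᵇ (λ u≡t → ℕP.<-irrefl (sym u≡t) t<u)) (multiplicity-absent c c<u)

module Sufficiency where

  open import Data.Bool using (true; false)
  open import Data.Nat as ℕ using (_∸_; _⊓_; _≡ᵇ_; _≤ᵇ_)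
  open import Data.Nat.ListAction using (sum)
  open import Data.Integer as ℤ using (ℤ; +_; _+_; _*_; _-_; 0ℤ; 1ℤ)
  import Data.Integer.Properties as ℤP
  open import Data.Integer.Tactic.RingSolver using (solve-∀)
  import Data.List.Relation.Unary.Linked as Linked
  open import Relation.Nullary.Reflects using (ofʸ)
  import Data.Fin.Properties as FinP
  import Data.List.Relation.Unary.All as All
  open import Data.List.Relation.Unary.All.Properties using (tabulate⁺)
  open AlternatingLine
  open FinSum
  open Selection using (_⊴_; select; select-map; ≼⇒⊴; z-sorted)
  open MonotoneTriangle

  multiplicity-01 : ∀ u {c} → Decreasing c → Is01 (+ multiplicity u c)
  multiplicity-01 u {[]} _ = inj₁ refl
  multiplicity-01 u {t ∷ c} t∷c↓ with u ≡ᵇ t | ≡ᵇ-reflects-≡ u t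
  ... | true | ofʸ refl = inj₂ (cong (λ m → + suc m) (multiplicity-absent c (Decreasing⇒head-max t∷c↓)))
  ... | false | _ = multiplicity-01 u (Linked.tail t∷c↓)

  zᴺ : ℕ → List ℕ
  zᴺ n = toList (λ (i : Fin n) → n ∸ toℕ i)

  zᴺ<1+n : ∀ n → All (ℕ._< suc n) (zᴺ n)
  zᴺ<1+n n = tabulate⁺ (λ i → s≤s (ℕP.m∸n≤m n (toℕ i)))

  zᴺ-decreasing : ∀ n → Decreasing (zᴺ n)
  zᴺ-decreasing zero = Linked.[]
  zᴺ-decreasing (suc zero) = Linked.[-]
  zᴺ-decreasing (suc (suc n)) = ℕP.n<1+n (suc n) Linked.∷ zᴺ-decreasing (suc n)

  zᴺ-inRange : ∀ n → All (InRange n) (zᴺ n)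
  zᴺ-inRange n = tabulate⁺ (λ i → ℕP.m<n⇒0<n∸m (FinP.toℕ<n i) , ℕP.m∸n≤m n (toℕ i))

  multiplicity-zᴺ : ∀ n {u} → 1 ℕ.≤ u → u ℕ.≤ n → multiplicity u (zᴺ n) ≡ 1
  multiplicity-zᴺ zero (s≤s _) ()
  multiplicity-zᴺ (suc n) {u} 1≤u u≤1+n with ℕP.m≤n⇒m<n∨m≡n u≤1+n
  ... | inj₂ refl = cong₂ ℕ._+_ (𝟙-≡ᵇ {suc n} refl) (multiplicity-absent (zᴺ n) (zᴺ<1+n n))
  ... | inj₁ (s≤s u≤n) = cong₂ ℕ._+_ (𝟙-≢ᵇ (λ u≡1+n → ℕP.<-irrefl u≡1+n (s≤s u≤n))) (multiplicity-zᴺ n 1≤u u≤n)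

  occurrences : ∀ n → List ℕ → Fin n → ℤ
  occurrences n c i = + multiplicity (n ∸ toℕ i) c

  prefixSum-occurrence : ∀ n r {t} → t ℕ.≤ n → r ℕ.≤ n →
    prefixSum {n} r (λ i → + 𝟙 (n ∸ toℕ i ≡ᵇ t)) ≡ + 𝟙 (suc n ∸ r ≤ᵇ t)
  prefixSum-occurrence n zero t≤n _ = cong +_ (sym (𝟙-≰ᵇ (s≤s t≤n)))
  prefixSum-occurrence (suc n) (suc r) {t} t≤1+n (s≤s r≤n) with ℕP.m≤n⇒m<n∨m≡n t≤1+n
  ... | inj₂ refl = begin
    + 𝟙 (suc n ≡ᵇ suc n) + prefixSum r (λ i → + 𝟙 (n ∸ toℕ i ≡ᵇ suc n))
      ≡⟨ cong₂ _+_ (cong +_ (𝟙-≡ᵇ {suc n} refl))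
                   (trans (prefixSum-cong r (λ i → cong +_ (𝟙-≢ᵇ (n∸i≢1+n i)))) (prefixSum-zero n r)) ⟩
    1ℤ + 0ℤ
      ≡⟨ cong +_ (𝟙-≤ᵇ (ℕP.m∸n≤m (suc n) r)) ⟨
    + 𝟙 (suc n ∸ r ≤ᵇ suc n)  ∎
    where
    open ≡-Reasoning
    n∸i≢1+n : ∀ (i : Fin n) → n ∸ toℕ i ≢ suc n
    n∸i≢1+n i e = ℕP.<-irrefl e (s≤s (ℕP.m∸n≤m n (toℕ i)))
  ... | inj₁ (s≤s t≤n) =
    trans (cong₂ _+_ (cong +_ (𝟙-≢ᵇ (λ 1+n≡t → ℕP.<-irrefl (sym 1+n≡t) (s≤s t≤n)))) (prefixSum-occurrence n r t≤n r≤n))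
          (ℤP.+-identityˡ _)

  prefixSum-occurrences : ∀ n r c → All (ℕ._≤ n) c → r ℕ.≤ n → prefixSum r (occurrences n c) ≡ + count≥ (suc n ∸ r) c
  prefixSum-occurrences n r [] _ _ = prefixSum-zero n r
  prefixSum-occurrences n r (t ∷ c) (t≤n ∷ c≤n) r≤n =
    trans (prefixSum-+ r (λ i → + 𝟙 (n ∸ toℕ i ≡ᵇ t)) (occurrences n c))
          (cong₂ _+_ (prefixSum-occurrence n r t≤n r≤n) (prefixSum-occurrences n r c c≤n r≤n))

  ∑-z*occurrence : ∀ n {t} → 1 ℕ.≤ t → t ℕ.≤ n → ∑ {n} (λ i → z n i * + 𝟙 (n ∸ toℕ i ≡ᵇ t)) ≡ + t
  ∑-z*occurrence zero (s≤s _) ()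
  ∑-z*occurrence (suc n) {t} 1≤t t≤1+n with ℕP.m≤n⇒m<n∨m≡n t≤1+n
  ... | inj₂ refl = begin
    + suc n * + 𝟙 (suc n ≡ᵇ suc n) + ∑ (λ i → z n i * + 𝟙 (n ∸ toℕ i ≡ᵇ suc n))
      ≡⟨ cong₂ _+_ (cong (λ b → + suc n * + b) (𝟙-≡ᵇ {suc n} refl))
                   (trans (∑-cong (λ i → cong (λ b → z n i * + b) (𝟙-≢ᵇ (n∸i≢1+n i)))) ∑-z*0) ⟩
    + suc n * 1ℤ + 0ℤ
      ≡⟨ trans (ℤP.+-identityʳ _) (ℤP.*-identityʳ _) ⟩
    + suc n  ∎
    where
    open ≡-Reasoning
    n∸i≢1+n : ∀ (i : Fin n) → n ∸ toℕ i ≢ suc n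
    n∸i≢1+n i e = ℕP.<-irrefl e (s≤s (ℕP.m∸n≤m n (toℕ i)))
    ∑-z*0 : ∑ (λ i → z n i * 0ℤ) ≡ 0ℤ
    ∑-z*0 = trans (∑-cong (λ i → ℤP.*-zeroʳ (z n i))) (∑-zero n)
  ... | inj₁ (s≤s t≤n) =
    trans (cong₂ _+_ (trans (cong (λ b → + suc n * + b) (𝟙-≢ᵇ (λ 1+n≡t → ℕP.<-irrefl (sym 1+n≡t) (s≤s t≤n))))
                            (ℤP.*-zeroʳ (+ suc n)))
                     (∑-z*occurrence n 1≤t t≤n))
          (ℤP.+-identityˡ _)

  ∑-z*occurrences : ∀ n c → All (InRange n) c → ∑ (λ i → z n i * occurrences n c i) ≡ + sum c
  ∑-z*occurrences n [] _ = trans (∑-cong (λ i → ℤP.*-zeroʳ (z n i))) (∑-zero n)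
  ∑-z*occurrences n (t ∷ c) ((1≤t , t≤n) ∷ c∈) = begin
    ∑ (λ i → z n i * (+ 𝟙 (n ∸ toℕ i ≡ᵇ t) + occurrences n c i))
      ≡⟨ ∑-cong (λ i → ℤP.*-distribˡ-+ (z n i) _ _) ⟩
    ∑ (λ i → z n i * + 𝟙 (n ∸ toℕ i ≡ᵇ t) + z n i * occurrences n c i)
      ≡⟨ ∑-+ {n} _ _ ⟩
    ∑ (λ i → z n i * + 𝟙 (n ∸ toℕ i ≡ᵇ t)) + ∑ (λ i → z n i * occurrences n c i)
      ≡⟨ cong₂ _+_ (∑-z*occurrence n 1≤t t≤n) (∑-z*occurrences n c c∈) ⟩
    + t + + sum c  ∎
    where open ≡-Reasoning

  Is01-⊖ : ∀ {a b} → Is01 a → Is01 b → Is0±1 (a - b)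
  Is01-⊖ (inj₁ refl) (inj₁ refl) = inj₁ refl
  Is01-⊖ (inj₁ refl) (inj₂ refl) = inj₂ (inj₂ refl)
  Is01-⊖ (inj₂ refl) (inj₁ refl) = inj₂ (inj₁ refl)
  Is01-⊖ (inj₂ refl) (inj₂ refl) = inj₁ refl

  Is01-complement : ∀ {a} → Is01 a → Is01 (1ℤ - a)
  Is01-complement (inj₁ refl) = inj₂ refl
  Is01-complement (inj₂ refl) = inj₁ refl

  +[1+m]-+m≡1 : ∀ m → + suc m - + m ≡ 1ℤ
  +[1+m]-+m≡1 m = cancel (+ m)
    where
    cancel : ∀ x → (1ℤ + x) - x ≡ 1ℤ
    cancel = solve-∀

  Is01-⊖-interlaced : ∀ {a b} → a ≡ b ⊎ a ≡ suc b → Is01 (+ a - + b)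
  Is01-⊖-interlaced {a} (inj₁ refl) = inj₁ (ℤP.+-inverseʳ (+ a))
  Is01-⊖-interlaced {b = b} (inj₂ refl) = inj₂ (+[1+m]-+m≡1 b)

  sumℤ-map+ : ∀ xs → sumℤ (map +_ xs) ≡ + sum xs
  sumℤ-map+ [] = refl
  sumℤ-map+ (x ∷ xs) = cong (_+_ (+ x)) (sumℤ-map+ xs)

  map+-⊴⇒selection≤ : ∀ {xs ys} → map +_ xs ⊴ map +_ ys →
                      ∀ bs → sum (select bs xs) ℕ.≤ sum (take (length (select bs xs)) ys)
  map+-⊴⇒selection≤ {xs} {ys} xs⊴ys bs = ℤP.drop‿+≤+ (subst₂ ℤ._≤_ lhs rhs (xs⊴ys bs))
    where
    lhs : sumℤ (select bs (map +_ xs)) ≡ + sum (select bs xs)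
    lhs = trans (cong sumℤ (select-map +_ bs xs)) (sumℤ-map+ (select bs xs))
    k≡ : length (select bs (map +_ xs)) ≡ length (select bs xs)
    k≡ = trans (cong length (select-map +_ bs xs)) (ListP.length-map +_ (select bs xs))
    rhs : sumℤ (take (length (select bs (map +_ xs))) (map +_ ys)) ≡ + sum (take (length (select bs xs)) ys)
    rhs = trans (cong (λ k → sumℤ (take k (map +_ ys))) k≡)
                (trans (cong sumℤ (ListP.take-map (length (select bs xs)) ys))
                       (sumℤ-map+ (take (length (select bs xs)) ys)))

  length≡0⇒[] : ∀ {A : Set} {xs : List A} → length xs ≡ 0 → xs ≡ []
  length≡0⇒[] {xs = []} _ = refl

  module Construction {n} (v : Fin n → ℤ) (v≥0 : ∀ j → 0ℤ ℤ.≤ v j) (v≼z : v ≼ z n) where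

    w : Fin n → ℕ
    w j = ℤ.∣ v j ∣

    +w≡v : ∀ j → + w j ≡ v j
    +w≡v j = ℤP.0≤i⇒+∣i∣≡i (v≥0 j)

    toList-v : toList v ≡ map +_ (toList w)
    toList-v = trans (sym (ListP.tabulate-cong +w≡v)) (sym (ListP.map-tabulate w (+_)))

    toList-z : toList (z n) ≡ map +_ (zᴺ n)
    toList-z = sym (ListP.map-tabulate (λ i → n ∸ toℕ i) (+_))

    w≼zᴺ : Majorized (toList w) (zᴺ n)
    w≼zᴺ = record
      { sum≡ = ℤP.+-injective (begin
          + sum (zᴺ n)              ≡⟨ sumℤ-map+ (zᴺ n) ⟨
          sumℤ (map +_ (zᴺ n))      ≡⟨ cong sumℤ toList-z ⟨
          sumℤ (toList (z n))       ≡⟨ proj₂ v≼z ⟨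
          sumℤ (toList v)           ≡⟨ cong sumℤ toList-v ⟩
          sumℤ (map +_ (toList w))  ≡⟨ sumℤ-map+ (toList w) ⟩
          + sum (toList w)          ∎)
      ; selection≤ = map+-⊴⇒selection≤ (subst₂ _⊴_ toList-v toList-z (≼⇒⊴ v (z n) (z-sorted n) v≼z))
      ; length≡ = trans (ListP.length-tabulate _) (sym (ListP.length-tabulate w))
      }
      where open ≡-Reasoning

    T : ℕ → List ℕ
    T = rows (zᴺ n) w

    T-good : ∀ k → GoodRow n (T k)
    T-good = rows-good (zᴺ n) w w≼zᴺ (zᴺ-decreasing n , zᴺ-inRange n)

    T-length : ∀ k → k ℕ.≤ n → length (T k) ≡ n ∸ k
    T-length k k≤n = trans (rows-length (zᴺ n) w w≼zᴺ k k≤n) (cong (_∸ k) (ListP.length-tabulate _))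

    T-last : T n ≡ []
    T-last = length≡0⇒[] (trans (T-length n ℕP.≤-refl) (ℕP.n∸n≡0 n))

    -- Row i of M stands for the value n ∸ i of z n.
    M : Matrix n
    M i j = occurrences n (T (toℕ j)) i - occurrences n (T (suc (toℕ j))) i

    occurrences-01 : ∀ k i → Is01 (occurrences n (T k) i)
    occurrences-01 k i = multiplicity-01 (n ∸ toℕ i) (proj₁ (T-good k))

    entries : ∀ i j → Is0±1 (M i j)
    entries i j = Is01-⊖ (occurrences-01 (toℕ j) i) (occurrences-01 (suc (toℕ j)) i)

    rowLine : ∀ i → ASMLine (M i)
    rowLine i = tailAlternating (prefixSums01⇒alternating (toList (M i)) prefixes01) , row-sum
      where
      g : ℕ → ℤ
      g k = occurrences n (T k) i
      g0≡1 : g 0 ≡ 1ℤ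
      g0≡1 = cong +_ (multiplicity-zᴺ n (ℕP.m<n⇒0<n∸m (FinP.toℕ<n i)) (ℕP.m∸n≤m n (toℕ i)))
      prefix≡ : ∀ r → prefixSum r (M i) ≡ 1ℤ - g (r ⊓ n)
      prefix≡ r = trans (prefixSum-telescope r g) (cong (_- g (r ⊓ n)) g0≡1)
      prefixes01 : ∀ r → Is01 (prefixSum r (M i))
      prefixes01 r = subst Is01 (sym (prefix≡ r)) (Is01-complement (occurrences-01 (r ⊓ n) i))
      row-sum : ∑ (M i) ≡ 1ℤ
      row-sum = begin
        ∑ (M i)                    ≡⟨ prefixSum-all (M i) ⟨
        prefixSum n (M i)          ≡⟨ prefix≡ n ⟩
        1ℤ - g (n ⊓ n)             ≡⟨ cong (λ k → 1ℤ - occurrences n (T k) i) (ℕP.⊓-idem n) ⟩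
        1ℤ - occurrences n (T n) i ≡⟨ cong (λ c → 1ℤ - occurrences n c i) T-last ⟩
        1ℤ - 0ℤ                    ∎
        where open ≡-Reasoning

    columnLine : ∀ j → ASMLine (λ i → M i j)
    columnLine j = tailAlternating (prefixSums01⇒alternating (toList (λ i → M i j)) prefixes01) , column-sum
      where
      k = toℕ j
      k<n = FinP.toℕ<n j
      below-n : ∀ m → All (ℕ._≤ n) (T m)
      below-n m = All.map proj₂ (proj₂ (T-good m))
      prefix≡ : ∀ r → r ℕ.≤ n →
                prefixSum r (λ i → M i j) ≡ + count≥ (suc n ∸ r) (T k) - + count≥ (suc n ∸ r) (T (suc k))
      prefix≡ r r≤n = trans (prefixSum-minus r (occurrences n (T k)) (occurrences n (T (suc k))))
                            (cong₂ _-_ (prefixSum-occurrences n r (T k) (below-n k) r≤n)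
                                       (prefixSum-occurrences n r (T (suc k)) (below-n (suc k)) r≤n))
      prefixes01 : ∀ r → Is01 (prefixSum r (λ i → M i j))
      prefixes01 r = subst Is01 (sym (trans (prefixSum-⊓ r (λ i → M i j)) (prefix≡ (r ⊓ n) (ℕP.m⊓n≤n r n))))
                       (Is01-⊖-interlaced (proj₂ (rows-step (zᴺ n) w w≼zᴺ j) (suc n ∸ (r ⊓ n))))
      count≥-1≡ : ∀ m → m ℕ.≤ n → count≥ (suc n ∸ n) (T m) ≡ n ∸ m
      count≥-1≡ m m≤n = begin
        count≥ (suc n ∸ n) (T m)  ≡⟨ cong (λ u → count≥ u (T m)) (ℕP.m+n∸n≡m 1 n) ⟩
        count≥ 1 (T m)            ≡⟨ count≥-1 (T m) (All.map proj₁ (proj₂ (T-good m))) ⟩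
        length (T m)              ≡⟨ T-length m m≤n ⟩
        n ∸ m                     ∎
        where open ≡-Reasoning
      column-sum : ∑ (λ i → M i j) ≡ 1ℤ
      column-sum = begin
        ∑ (λ i → M i j)                     ≡⟨ prefixSum-all (λ i → M i j) ⟨
        prefixSum n (λ i → M i j)           ≡⟨ prefix≡ n ℕP.≤-refl ⟩
        + count≥ (suc n ∸ n) (T k) - + count≥ (suc n ∸ n) (T (suc k))
          ≡⟨ cong₂ (λ a b → + a - + b) (count≥-1≡ k (ℕP.<⇒≤ k<n)) (count≥-1≡ (suc k) k<n) ⟩
        + (n ∸ k) - + (n ∸ suc k)           ≡⟨ cong (λ a → + a - + (n ∸ suc k)) (ℕP.+-∸-assoc 1 k<n) ⟩
        + suc (n ∸ suc k) - + (n ∸ suc k)   ≡⟨ +[1+m]-+m≡1 (n ∸ suc k) ⟩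
        1ℤ                                  ∎
        where open ≡-Reasoning

    isASM : IsASM M
    isASM = entries , rowLine , columnLine

    weightedProjection≡v : ∀ j → weightedProjection M j ≡ v j
    weightedProjection≡v j = begin
      ∑ (λ i → z n i * (occurrences n (T k) i - occurrences n (T (suc k)) i))
        ≡⟨ ∑-cong (λ i → *-distribˡ-minus (z n i) _ _) ⟩
      ∑ (λ i → z n i * occurrences n (T k) i - z n i * occurrences n (T (suc k)) i)
        ≡⟨ ∑-minus {n} _ _ ⟩
      ∑ (λ i → z n i * occurrences n (T k) i) - ∑ (λ i → z n i * occurrences n (T (suc k)) i)
        ≡⟨ cong₂ _-_ (∑-z*occurrences n (T k) (proj₂ (T-good k)))
                     (∑-z*occurrences n (T (suc k)) (proj₂ (T-good (suc k)))) ⟩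
      + sum (T k) - + sum (T (suc k))
        ≡⟨ cong (λ s → + s - + sum (T (suc k))) (proj₁ (rows-step (zᴺ n) w w≼zᴺ j)) ⟩
      + (w j ℕ.+ sum (T (suc k))) - + sum (T (suc k))
        ≡⟨ cancel (+ w j) (+ sum (T (suc k))) ⟩
      + w j
        ≡⟨ +w≡v j ⟩
      v j ∎
      where
      open ≡-Reasoning
      k = toℕ j
      *-distribˡ-minus : ∀ a b c → a * (b - c) ≡ a * b - a * c
      *-distribˡ-minus = solve-∀
      cancel : ∀ x y → (x + y) - y ≡ x
      cancel = solve-∀

  ≼z⇒asm : ∀ {n} (v : Fin n → ℤ) → (∀ j → 0ℤ ℤ.≤ v j) → v ≼ z n →
           ∃ λ (M : Matrix n) → IsASM M × (∀ j → weightedProjection M j ≡ v j)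
  ≼z⇒asm v v≥0 v≼z = M , isASM , weightedProjection≡v
    where open Construction v v≥0 v≼z

open import Data.Nat using (_≥_)
open import Data.Integer using (ℤ; _>_; 0ℤ)
import Data.Integer.Properties as ℤP
open import Data.Product using (Σ)
open import Function.Bundles using (_⇔_; mk⇔)
open Necessity using (asm⇒≼z)
open Sufficiency using (≼z⇒asm)

theorem2p7 : (n : ℕ) → n ≥ 1 → (v : Fin n → ℤ) → (∀ i → v i > 0ℤ) →
    (Σ (Matrix n) (λ A → IsASM A × (∀ j → weightedProjection A j ≡ v j))) ⇔ (v ≼ z n)
theorem2p7 n _ v v>0 =
  mk⇔ (λ (A , asm , wp≡v) → asm⇒≼z A asm wp≡v) (≼z⇒asm v (λ j → ℤP.<⇒≤ (v>0 j)))
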